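{- Let $\Psi_1=\left\langle\begin{pmatrix}1&1\\0&1\end{pmatrix},\begin{pmatrix}1&0\\4&1\end{pmatrix}\right\rangle^+$ and $\Psi_2=\left\langle\begin{pmatrix}1&4\\0&1\end{pmatrix},\begin{pmatrix}1&0\\4&1\end{pmatrix}\right\rangle^+$. For a positive integer $n$ and $i\in\{1,2\}$, let $\Psi_i/n$ denote the image of $\Psi_i$ under reduction $\mathrm{SL}(2,\mathbb{Z})\to\mathrm{SL}(2,\mathbb{Z}/n\mathbb{Z})$, and similarly $\mathrm{SL}(2,\mathbb{Z})/n$. Write $n=n_{\mathrm{odd}}\,n'$ with $n_{\mathrm{odd}}$ odd and $n'$ a power of $2$. Then for $i\in\{1,2\}$: (1) $\Psi_i/n\cong\Psi_i/n_{\mathrm{odd}}\times\Psi_i/n'$ (via the Chinese remainder isomorphism $\mathrm{SL}(2,\mathbb{Z}/n)\cong\mathrm{SL}(2,\mathbb{Z}/n_{\mathrm{odd}})\times\mathrm{SL}(2,\mathbb{Z}/n')$); (2) $\Psi_i/n_{\mathrm{odd}}=\mathrm{SL}(2,\mathbb{Z})/n_{\mathrm{odd}}$; (3) there is an exponent $e_i\geq1$ such that for all $k\geq e_i$, $\Psi_i/2^k$ is the full preimage of $\Psi_i/2^{e_i}$ under the reduction map $\mathrm{SL}(2,\mathbb{Z}/2^k)\to\mathrm{SL}(2,\mathbb{Z}/2^{e_i})$; (4) one may take $e_1=2$ and $e_2=4$.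
   Context: $\langle A_1,\dots,A_k\rangle^+$ is the monoid generated by the $A_i$ and the identity. -}

module Defs where

open import Data.Nat using (ℕ; suc; _^_; _≥_) renaming (_*_ to _*ℕ_)
open import Data.Integer using (ℤ; +_; _-_; _+_; _*_; 0ℤ; 1ℤ)
open import Data.Integer.Divisibility using (_∣_)
open import Data.Product using (_×_; ∃)
open import Relation.Binary.PropositionalEquality using (_≡_)

record Mat : Set where
  constructor mat
  field
    a b c d : ℤ

open Mat public

_·_ : Mat → Mat → Mat
mat a₁ b₁ c₁ d₁ · mat a₂ b₂ c₂ d₂ =
  mat (a₁ * a₂ + b₁ * c₂) (a₁ * b₂ + b₁ * d₂)
      (c₁ * a₂ + d₁ * c₂) (c₁ * b₂ + d₁ * d₂)

I₂ : Mat
I₂ = mat 1ℤ 0ℤ 0ℤ 1ℤ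

det : Mat → ℤ
det (mat a b c d) = a * d - b * c

InSL2ℤ : Mat → Set
InSL2ℤ M = det M ≡ 1ℤ

_≡_[mod_] : ℤ → ℤ → ℕ → Set
x ≡ y [mod n ] = (+ n) ∣ (x - y)

_≋_[mod_] : Mat → Mat → ℕ → Set
M ≋ N [mod n ] =
  (a M ≡ a N [mod n ]) × (b M ≡ b N [mod n ]) ×
  (c M ≡ c N [mod n ]) × (d M ≡ d N [mod n ])

-- An element of SL(2, ℤ/nℤ), represented by an integer matrix (any lift):
-- its determinant is 1 modulo n.
InSL2mod : ℕ → Mat → Set
InSL2mod n M = det M ≡ 1ℤ [mod n ]

data Generated (S : Mat → Set) : Mat → Set where
  gen-id  : Generated S I₂
  gen-inc : ∀ {M} → S M → Generated S M
  gen-mul : ∀ {M N} → Generated S M → Generated S N → Generated S (M · N)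

-- image of a set of integer matrices under reduction mod n,
-- as a predicate on integer matrices (lifts of elements of M₂(ℤ/n))
_mod_ : (Mat → Set) → ℕ → (Mat → Set)
(P mod n) M = ∃ λ A → P A × (A ≋ M [mod n ])

data Idx : Set where
  one two : Idx

data Gens : Idx → Mat → Set where
  g1a : Gens one (mat 1ℤ 1ℤ 0ℤ 1ℤ)
  g1b : Gens one (mat 1ℤ 0ℤ (+ 4) 1ℤ)
  g2a : Gens two (mat 1ℤ (+ 4) 0ℤ 1ℤ)
  g2b : Gens two (mat 1ℤ 0ℤ (+ 4) 1ℤ)

Ψ : Idx → Mat → Set
Ψ i = Generated (Gens i)

e : Idx → ℕ
e one = 2
e two = 4

Odd : ℕ → Set
Odd m = ∃ λ t → m ≡ suc (2 *ℕ t)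

-- (1) CRT splitting, for n = m · 2^k with m odd (n positive automatically)
Part1 : Idx → Set
Part1 i = ∀ (m k : ℕ) → Odd m → ∀ (M : Mat) →
  ((Ψ i mod (m *ℕ 2 ^ k)) M → (Ψ i mod m) M × (Ψ i mod (2 ^ k)) M) ×
  ((Ψ i mod m) M × (Ψ i mod (2 ^ k)) M → (Ψ i mod (m *ℕ 2 ^ k)) M)

Part2 : Idx → Set
Part2 i = ∀ (m : ℕ) → Odd m → ∀ (M : Mat) →
  ((Ψ i mod m) M → (InSL2ℤ mod m) M) × ((InSL2ℤ mod m) M → (Ψ i mod m) M)

FullPreimageFrom : Idx → ℕ → Set
FullPreimageFrom i e₀ = ∀ (k : ℕ) → k ≥ e₀ → ∀ (M : Mat) →
  ((Ψ i mod (2 ^ k)) M → InSL2mod (2 ^ k) M × (Ψ i mod (2 ^ e₀)) M) ×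
  (InSL2mod (2 ^ k) M × (Ψ i mod (2 ^ e₀)) M → (Ψ i mod (2 ^ k)) M)

Part3 : Idx → Set
Part3 i = ∃ λ e₀ → (e₀ ≥ 1) × FullPreimageFrom i e₀

Part4 : Idx → Set
Part4 i = FullPreimageFrom i (e i)

-- Ψ₂ ⊆ Ψ₁, and Ψ₂ contains upper (4j) and lower (4j) for all j ∈ ℕ. Modulo an odd m
-- both 4 and 2^k are units, so every elementary matrix upper x, lower x is congruent
-- modulo m to one of these which is ≡ I modulo 2^k. Since Euclid's algorithm writes
-- every element of SL(2,ℤ) as a product of elementary matrices, Ψ₂ ∩ Γ(2^k) maps onto
-- SL(2,ℤ/m). This is (2), and it gives (1): if A₁, A₂ ∈ Ψ_i agree with M modulo m and
-- 2^k, then so does A₂ X modulo both, where X ∈ Ψ₂ ∩ Γ(2^k) and X ≡ A₂⁻¹ A₁ modulo m.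
-- For (3), let P = 2^(j+2). Modulo 2P, a matrix I + P Y of determinant 1 has tr Y
-- even and only depends on Y modulo 2, hence equals upper (ε₂ P) · lower (ε₃ P) · W^ε₁
-- for some ε's in {0, 1}, as soon as Ψ_i contains a W ≡ (1 + P) I modulo 2P. Then W²
-- is such an element for 2P, so a single W (T³LTL ≡ 5 I mod 8 in Ψ₁, T⁷LTL⁷ ≡ 17 I
-- mod 32 in Ψ₂, for the generators T, L) lifts Ψ_i / 2^e one power of 2 at a time.
module Submission where

open import Data.Integer
  using (ℤ; +_; -[1+_]; +[1+_]; _+_; _-_; _*_; -_; 0ℤ; 1ℤ; -1ℤ; ∣_∣; _%_; _/_; _%ℕ_; _/ℕ_)
import Data.Integer as ℤ
open import Data.Integer.DivMod using (a≡a%n+[a/n]*n; a≡a%ℕn+[a/ℕn]*n; n%d<d; n%ℕd<d)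
import Data.Integer.Divisibility.Signed as Signed
import Data.Integer.Properties as ℤₚ
open import Data.Integer.Tactic.RingSolver using (solve-∀)
import Data.Nat as ℕ
open import Data.Nat using (ℕ; zero; suc)
open import Data.Nat.Divisibility
  using (_∣_; divides; ∣-trans; m∣m*n; n∣m*n; ∣m⇒∣m*n; ∣n⇒∣m*n; *-monoʳ-∣)
open import Data.Nat.Induction using (<-wellFounded)
import Data.Nat.Properties as ℕₚ
open import Data.Product using (_×_; _,_; ∃; proj₁; proj₂)
open import Data.Sum using (_⊎_; inj₁; inj₂)
open import Function using (_∘_; id)
open import Induction.WellFounded using (Acc; acc)
open import Level using (0ℓ)
open import Relation.Binary.Bundles using (Setoid)
open import Relation.Binary.PropositionalEquality
open import Relation.Binary.Structures using (IsEquivalence)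

open import Defs

private
  variable
    m n : ℕ
    x y z x′ y′ : ℤ
    M N O M′ N′ : Mat

-- Unlike `_≡_[mod_]`, which only constrains ∣ x - y ∣, this relation keeps x and y
-- as indices, so that they can be inferred by unification.
infix 4 _≡_⟨mod_⟩

record _≡_⟨mod_⟩ (x y : ℤ) (n : ℕ) : Set where
  constructor by-quotient
  field
    quotient : ℤ
    equality : x ≡ y + quotient * + n

≡-mod-intro : ∀ {N} q → + n ≡ N → x ≡ y + q * N → x ≡ y ⟨mod n ⟩
≡-mod-intro q refl eq = by-quotient q eq

≡-mod-elim : ∀ {N} → + n ≡ N → x ≡ y ⟨mod n ⟩ → ∃ λ q → x ≡ y + q * N
≡-mod-elim refl (by-quotient q eq) = q , eq

⟨mod⟩⇒[mod] : x ≡ y ⟨mod n ⟩ → x ≡ y [mod n ]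
⟨mod⟩⇒[mod] {y = y} (by-quotient q refl) = Signed.∣⇒∣ᵤ (Signed.divides q (ring y (q * _)))
  where
  ring : ∀ y t → y + t - y ≡ t
  ring = solve-∀

[mod]⇒⟨mod⟩ : x ≡ y [mod n ] → x ≡ y ⟨mod n ⟩
[mod]⇒⟨mod⟩ {x} {y} x≡y with Signed.∣ᵤ⇒∣ x≡y
... | Signed.divides q x-y≡qn = by-quotient q (trans (ring x y) (cong (_+_ y) x-y≡qn))
  where
  ring : ∀ x y → x ≡ y + (x - y)
  ring = solve-∀

≡-mod-reflexive : x ≡ y → x ≡ y ⟨mod n ⟩
≡-mod-reflexive {x} refl = by-quotient 0ℤ (sym (ℤₚ.+-identityʳ x))

≡-mod-refl : x ≡ x ⟨mod n ⟩
≡-mod-refl = ≡-mod-reflexive refl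

≡-mod-sym : x ≡ y ⟨mod n ⟩ → y ≡ x ⟨mod n ⟩
≡-mod-sym {y = y} {n} (by-quotient q refl) = by-quotient (- q) (ring y q (+ n))
  where
  ring : ∀ y q n → y ≡ y + q * n + - q * n
  ring = solve-∀

≡-mod-trans : x ≡ y ⟨mod n ⟩ → y ≡ z ⟨mod n ⟩ → x ≡ z ⟨mod n ⟩
≡-mod-trans {n = n} {z} (by-quotient q refl) (by-quotient r refl) = by-quotient (r + q) (ring z r q (+ n))
  where
  ring : ∀ z r q n → z + r * n + q * n ≡ z + (r + q) * n
  ring = solve-∀

≡-mod-isEquivalence : IsEquivalence (_≡_⟨mod n ⟩)
≡-mod-isEquivalence = record { refl = ≡-mod-refl ; sym = ≡-mod-sym ; trans = ≡-mod-trans }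

≡-mod-setoid : ℕ → Setoid 0ℓ 0ℓ
≡-mod-setoid n = record { isEquivalence = ≡-mod-isEquivalence {n} }

module ≡-mod-Reasoning (n : ℕ) where
  open import Relation.Binary.Reasoning.Setoid (≡-mod-setoid n) public

+-cong-mod : x ≡ y ⟨mod n ⟩ → x′ ≡ y′ ⟨mod n ⟩ → x + x′ ≡ y + y′ ⟨mod n ⟩
+-cong-mod {y = y} {n} {y′ = y′} (by-quotient q refl) (by-quotient r refl) =
  by-quotient (q + r) (ring y y′ q r (+ n))
  where
  ring : ∀ y y′ q r n → y + q * n + (y′ + r * n) ≡ y + y′ + (q + r) * n
  ring = solve-∀

*-cong-mod : x ≡ y ⟨mod n ⟩ → x′ ≡ y′ ⟨mod n ⟩ → x * x′ ≡ y * y′ ⟨mod n ⟩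
*-cong-mod {y = y} {n} {y′ = y′} (by-quotient q refl) (by-quotient r refl) =
  by-quotient (q * y′ + y * r + q * r * + n) (ring y y′ q r (+ n))
  where
  ring : ∀ y y′ q r n → (y + q * n) * (y′ + r * n) ≡ y * y′ + (q * y′ + y * r + q * r * n) * n
  ring = solve-∀

neg-cong-mod : x ≡ y ⟨mod n ⟩ → - x ≡ - y ⟨mod n ⟩
neg-cong-mod {y = y} {n} (by-quotient q refl) = by-quotient (- q) (ring y q (+ n))
  where
  ring : ∀ y q n → - (y + q * n) ≡ - y + - q * n
  ring = solve-∀

minus-cong-mod : x ≡ y ⟨mod n ⟩ → x′ ≡ y′ ⟨mod n ⟩ → x - x′ ≡ y - y′ ⟨mod n ⟩
minus-cong-mod x≡y x′≡y′ = +-cong-mod x≡y (neg-cong-mod x′≡y′)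

*-scale-mod : x ≡ y ⟨mod m ⟩ → x * + n ≡ y * + n ⟨mod m ℕ.* n ⟩
*-scale-mod {y = y} {m} {n} (by-quotient q refl) = ≡-mod-intro q (ℤₚ.pos-* m n) (ring y q (+ m) (+ n))
  where
  ring : ∀ y q m n → (y + q * m) * n ≡ y * n + q * (m * n)
  ring = solve-∀

≡-mod-divisor : m ∣ n → x ≡ y ⟨mod n ⟩ → x ≡ y ⟨mod m ⟩
≡-mod-divisor m∣n x≡y = [mod]⇒⟨mod⟩ (∣-trans m∣n (⟨mod⟩⇒[mod] x≡y))

∣⇒≡0-mod : n ∣ m → + m ≡ 0ℤ ⟨mod n ⟩
∣⇒≡0-mod {n} (divides q refl) = ≡-mod-intro (+ q) refl (trans (ℤₚ.pos-* q n) (sym (ℤₚ.+-identityˡ _)))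

≡%ℕ-mod : ∀ x n .{{_ : ℕ.NonZero n}} → x ≡ + (x %ℕ n) ⟨mod n ⟩
≡%ℕ-mod x n = by-quotient (x /ℕ n) (a≡a%ℕn+[a/ℕn]*n x n)

≡-mod-crt : (∃ λ u → u * + n ≡ 1ℤ ⟨mod m ⟩) →
            x ≡ y ⟨mod m ⟩ → x ≡ y ⟨mod n ⟩ → x ≡ y ⟨mod m ℕ.* n ⟩
≡-mod-crt {n} {m} {y = y} (u , un≡1) x≡y (by-quotient q refl) =
  let by-quotient s q≡sm = q≡0 in
  ≡-mod-intro s (ℤₚ.pos-* m n) (trans (cong (λ q → y + q * + n) q≡sm) (ring y s (+ m) (+ n)))
  where
  open ≡-mod-Reasoning m
  ring : ∀ y s m n → y + (0ℤ + s * m) * n ≡ y + s * (m * n)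
  ring = solve-∀
  shuffle : ∀ q u n → q * (u * n) ≡ u * (q * n)
  shuffle = solve-∀
  difference : ∀ y t → y + t - y ≡ t
  difference = solve-∀
  qn≡0 : q * + n ≡ 0ℤ ⟨mod m ⟩
  qn≡0 = begin
    q * + n           ≡⟨ difference y (q * + n) ⟨
    y + q * + n - y   ≈⟨ minus-cong-mod x≡y (≡-mod-refl {y}) ⟩
    y - y             ≡⟨ ℤₚ.+-inverseʳ y ⟩
    0ℤ                ∎
  q≡0 : q ≡ 0ℤ ⟨mod m ⟩
  q≡0 = begin
    q                 ≡⟨ ℤₚ.*-identityʳ q ⟨
    q * 1ℤ            ≈⟨ *-cong-mod (≡-mod-refl {q}) un≡1 ⟨
    q * (u * + n)     ≡⟨ shuffle q u (+ n) ⟩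
    u * (q * + n)     ≈⟨ *-cong-mod (≡-mod-refl {u}) qn≡0 ⟩
    u * 0ℤ            ≡⟨ ℤₚ.*-zeroʳ u ⟩
    0ℤ                ∎

multiple-representative : ∀ {m} .{{_ : ℕ.NonZero m}} n → (∃ λ u → u * + n ≡ 1ℤ ⟨mod m ⟩) →
                          ∀ x → ∃ λ r → + (n ℕ.* r) ≡ x ⟨mod m ⟩
multiple-representative {m} n (u , un≡1) x = r , (begin
  + (n ℕ.* r)     ≡⟨ ℤₚ.pos-* n r ⟩
  + n * + r       ≈⟨ *-cong-mod (≡-mod-refl {+ n}) (≡%ℕ-mod (x * u) m) ⟨
  + n * (x * u)   ≡⟨ ring (+ n) x u ⟩
  x * (u * + n)   ≈⟨ *-cong-mod (≡-mod-refl {x}) un≡1 ⟩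
  x * 1ℤ          ≡⟨ ℤₚ.*-identityʳ x ⟩
  x               ∎)
  where
  open ≡-mod-Reasoning m
  r = (x * u) %ℕ m
  ring : ∀ n x u → n * (x * u) ≡ x * (u * n)
  ring = solve-∀

2*[1+t]≡1 : ∀ t → + 2 * + suc t ≡ 1ℤ ⟨mod suc (2 ℕ.* t) ⟩
2*[1+t]≡1 t = ≡-mod-intro 1ℤ (cong (_+_ 1ℤ) (ℤₚ.pos-* 2 t)) (ring (+ t))
  where
  ring : ∀ t → + 2 * (1ℤ + t) ≡ 1ℤ + 1ℤ * (1ℤ + + 2 * t)
  ring = solve-∀

2^-invertible-mod-odd : ∀ t k → ∃ λ u → u * + (2 ℕ.^ k) ≡ 1ℤ ⟨mod suc (2 ℕ.* t) ⟩
2^-invertible-mod-odd t zero    = 1ℤ , ≡-mod-refl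
2^-invertible-mod-odd t (suc k) =
  let u , u2^k≡1 = 2^-invertible-mod-odd t k in
  + suc t * u , ≡-mod-trans (≡-mod-reflexive (regroup u)) (*-cong-mod (2*[1+t]≡1 t) u2^k≡1)
  where
  ring : ∀ h u p → h * u * (+ 2 * p) ≡ + 2 * h * (u * p)
  ring = solve-∀
  regroup : ∀ u → + suc t * u * + (2 ℕ.^ suc k) ≡ + 2 * + suc t * (u * + (2 ℕ.^ k))
  regroup u = trans (cong (λ p → + suc t * u * p) (ℤₚ.pos-* 2 (2 ℕ.^ k))) (ring (+ suc t) u (+ (2 ℕ.^ k)))

mat-cong : ∀ {a b c d a′ b′ c′ d′} →
           a ≡ a′ → b ≡ b′ → c ≡ c′ → d ≡ d′ → mat a b c d ≡ mat a′ b′ c′ d′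
mat-cong refl refl refl refl = refl

scalar : ℤ → Mat
scalar s = mat s 0ℤ 0ℤ s

adj : Mat → Mat
adj (mat a b c d) = mat d (- b) (- c) a

upper lower : ℤ → Mat
upper x = mat 1ℤ x 0ℤ 1ℤ
lower x = mat 1ℤ 0ℤ x 1ℤ

S : Mat
S = mat 0ℤ -1ℤ 1ℤ 0ℤ

infixl 6 _⊕_
infixl 7 _⊛_

_⊕_ : Mat → Mat → Mat
M ⊕ N = mat (a M + a N) (b M + b N) (c M + c N) (d M + d N)

_⊛_ : Mat → ℤ → Mat
M ⊛ k = mat (a M * k) (b M * k) (c M * k) (d M * k)

·-assoc : ∀ M N O → (M · N) · O ≡ M · (N · O)
·-assoc (mat a₁ b₁ c₁ d₁) (mat a₂ b₂ c₂ d₂) (mat a₃ b₃ c₃ d₃) =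
  mat-cong (entry a₁ b₁ a₃ c₃) (entry a₁ b₁ b₃ d₃) (entry c₁ d₁ a₃ c₃) (entry c₁ d₁ b₃ d₃)
  where
  ring : ∀ x y z w a₂ b₂ c₂ d₂ → (x * a₂ + y * c₂) * z + (x * b₂ + y * d₂) * w ≡
                                 x * (a₂ * z + b₂ * w) + y * (c₂ * z + d₂ * w)
  ring = solve-∀
  entry : ∀ x y z w → (x * a₂ + y * c₂) * z + (x * b₂ + y * d₂) * w ≡
                      x * (a₂ * z + b₂ * w) + y * (c₂ * z + d₂ * w)
  entry x y z w = ring x y z w a₂ b₂ c₂ d₂

·-identityˡ : ∀ M → I₂ · M ≡ M
·-identityˡ (mat a b c d) = mat-cong (ring a c) (ring b d) (ring′ a c) (ring′ b d)
  where
  ring : ∀ x y → 1ℤ * x + 0ℤ * y ≡ x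
  ring = solve-∀
  ring′ : ∀ x y → 0ℤ * x + 1ℤ * y ≡ y
  ring′ = solve-∀

·-identityʳ : ∀ M → M · I₂ ≡ M
·-identityʳ (mat a b c d) = mat-cong (ring a b) (ring′ a b) (ring c d) (ring′ c d)
  where
  ring : ∀ x y → x * 1ℤ + y * 0ℤ ≡ x
  ring = solve-∀
  ring′ : ∀ x y → x * 0ℤ + y * 1ℤ ≡ y
  ring′ = solve-∀

det-· : ∀ M N → det (M · N) ≡ det M * det N
det-· (mat a₁ b₁ c₁ d₁) (mat a₂ b₂ c₂ d₂) = ring a₁ b₁ c₁ d₁ a₂ b₂ c₂ d₂
  where
  ring : ∀ a₁ b₁ c₁ d₁ a₂ b₂ c₂ d₂ →
         (a₁ * a₂ + b₁ * c₂) * (c₁ * b₂ + d₁ * d₂) -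
         (a₁ * b₂ + b₁ * d₂) * (c₁ * a₂ + d₁ * c₂) ≡
         (a₁ * d₁ - b₁ * c₁) * (a₂ * d₂ - b₂ * c₂)
  ring = solve-∀

det-adj : ∀ M → det (adj M) ≡ det M
det-adj (mat a b c d) = ring a b c d
  where
  ring : ∀ a b c d → d * a - - b * - c ≡ a * d - b * c
  ring = solve-∀

·-adj : ∀ M → M · adj M ≡ scalar (det M)
·-adj (mat a b c d) = mat-cong (diagonal a b c d) (off a b) (off′ c d) (diagonal′ a b c d)
  where
  diagonal : ∀ a b c d → a * d + b * - c ≡ a * d - b * c
  diagonal = solve-∀
  diagonal′ : ∀ a b c d → c * - b + d * a ≡ a * d - b * c
  diagonal′ = solve-∀
  off : ∀ x y → x * - y + y * x ≡ 0ℤ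
  off = solve-∀
  off′ : ∀ x y → x * y + y * - x ≡ 0ℤ
  off′ = solve-∀

adj-· : ∀ M → adj M · M ≡ scalar (det M)
adj-· (mat a b c d) = mat-cong (diagonal a b c d) (off b d) (off′ a c) (diagonal′ a b c d)
  where
  diagonal : ∀ a b c d → d * a + - b * c ≡ a * d - b * c
  diagonal = solve-∀
  diagonal′ : ∀ a b c d → - c * b + a * d ≡ a * d - b * c
  diagonal′ = solve-∀
  off : ∀ x y → y * x + - x * y ≡ 0ℤ
  off = solve-∀
  off′ : ∀ x y → - y * x + x * y ≡ 0ℤ
  off′ = solve-∀

det≡1⇒·adj-cancelˡ : ∀ A M → det A ≡ 1ℤ → A · (adj A · M) ≡ M
det≡1⇒·adj-cancelˡ A M detA≡1 = begin
  A · (adj A · M)   ≡⟨ ·-assoc A (adj A) M ⟨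
  (A · adj A) · M   ≡⟨ cong (_· M) (trans (·-adj A) (cong scalar detA≡1)) ⟩
  I₂ · M            ≡⟨ ·-identityˡ M ⟩
  M                 ∎
  where open ≡-Reasoning

det≡1⇒det-adj-· : ∀ A M → det A ≡ 1ℤ → det (adj A · M) ≡ det M
det≡1⇒det-adj-· A M detA≡1 = begin
  det (adj A · M)       ≡⟨ det-· (adj A) M ⟩
  det (adj A) * det M   ≡⟨ cong (_* det M) (trans (det-adj A) detA≡1) ⟩
  1ℤ * det M            ≡⟨ ℤₚ.*-identityˡ (det M) ⟩
  det M                 ∎
  where open ≡-Reasoning

upper-+ : ∀ x y → upper x · upper y ≡ upper (x + y)
upper-+ x y = mat-cong (ring-a x) (ring-b x y) refl refl
  where
  ring-a : ∀ x → 1ℤ * 1ℤ + x * 0ℤ ≡ 1ℤ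
  ring-a = solve-∀
  ring-b : ∀ x y → 1ℤ * y + x * 1ℤ ≡ x + y
  ring-b = solve-∀

lower-+ : ∀ x y → lower x · lower y ≡ lower (x + y)
lower-+ x y = mat-cong refl refl (ring-c x y) (ring-d x)
  where
  ring-c : ∀ x y → x * 1ℤ + 1ℤ * y ≡ x + y
  ring-c = solve-∀
  ring-d : ∀ x → x * 0ℤ + 1ℤ * 1ℤ ≡ 1ℤ
  ring-d = solve-∀

infix 4 _≋_⟨mod_⟩ _∈_⟨mod_⟩

record _≋_⟨mod_⟩ (M N : Mat) (n : ℕ) : Set where
  constructor entrywise
  field
    a≡ : a M ≡ a N ⟨mod n ⟩
    b≡ : b M ≡ b N ⟨mod n ⟩
    c≡ : c M ≡ c N ⟨mod n ⟩
    d≡ : d M ≡ d N ⟨mod n ⟩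

≋⟨mod⟩⇒≋[mod] : M ≋ N ⟨mod n ⟩ → M ≋ N [mod n ]
≋⟨mod⟩⇒≋[mod] (entrywise p q r s) =
  ⟨mod⟩⇒[mod] p , ⟨mod⟩⇒[mod] q , ⟨mod⟩⇒[mod] r , ⟨mod⟩⇒[mod] s

≋[mod]⇒≋⟨mod⟩ : M ≋ N [mod n ] → M ≋ N ⟨mod n ⟩
≋[mod]⇒≋⟨mod⟩ (p , q , r , s) =
  entrywise ([mod]⇒⟨mod⟩ p) ([mod]⇒⟨mod⟩ q) ([mod]⇒⟨mod⟩ r) ([mod]⇒⟨mod⟩ s)

≋-intro : ∀ {P} Q → + n ≡ P → M ≡ N ⊕ Q ⊛ P → M ≋ N ⟨mod n ⟩
≋-intro Q refl refl =
  entrywise (by-quotient (a Q) refl) (by-quotient (b Q) refl) (by-quotient (c Q) refl) (by-quotient (d Q) refl)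

≋-elim : ∀ {P} → + n ≡ P → M ≋ N ⟨mod n ⟩ → ∃ λ Q → M ≡ N ⊕ Q ⊛ P
≋-elim refl (entrywise (by-quotient q₁ e₁) (by-quotient q₂ e₂) (by-quotient q₃ e₃) (by-quotient q₄ e₄)) =
  mat q₁ q₂ q₃ q₄ , mat-cong e₁ e₂ e₃ e₄

≋-reflexive : M ≡ N → M ≋ N ⟨mod n ⟩
≋-reflexive refl = entrywise ≡-mod-refl ≡-mod-refl ≡-mod-refl ≡-mod-refl

≋-refl : M ≋ M ⟨mod n ⟩
≋-refl = ≋-reflexive refl

≋-sym : M ≋ N ⟨mod n ⟩ → N ≋ M ⟨mod n ⟩
≋-sym (entrywise p q r s) = entrywise (≡-mod-sym p) (≡-mod-sym q) (≡-mod-sym r) (≡-mod-sym s)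

≋-trans : M ≋ N ⟨mod n ⟩ → N ≋ O ⟨mod n ⟩ → M ≋ O ⟨mod n ⟩
≋-trans (entrywise p q r s) (entrywise p′ q′ r′ s′) =
  entrywise (≡-mod-trans p p′) (≡-mod-trans q q′) (≡-mod-trans r r′) (≡-mod-trans s s′)

·-cong-mod : M ≋ M′ ⟨mod n ⟩ → N ≋ N′ ⟨mod n ⟩ → M · N ≋ M′ · N′ ⟨mod n ⟩
·-cong-mod (entrywise p q r s) (entrywise p′ q′ r′ s′) =
  entrywise (+-cong-mod (*-cong-mod p p′) (*-cong-mod q r′)) (+-cong-mod (*-cong-mod p q′) (*-cong-mod q s′))
            (+-cong-mod (*-cong-mod r p′) (*-cong-mod s r′)) (+-cong-mod (*-cong-mod r q′) (*-cong-mod s s′))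

det-cong-mod : M ≋ N ⟨mod n ⟩ → det M ≡ det N ⟨mod n ⟩
det-cong-mod (entrywise p q r s) = minus-cong-mod (*-cong-mod p s) (*-cong-mod q r)

scalar-cong-mod : x ≡ y ⟨mod n ⟩ → scalar x ≋ scalar y ⟨mod n ⟩
scalar-cong-mod x≡y = entrywise x≡y ≡-mod-refl ≡-mod-refl x≡y

⊕⊛-cong-mod : M ≋ M′ ⟨mod m ⟩ → N ⊕ M ⊛ + n ≋ N ⊕ M′ ⊛ + n ⟨mod m ℕ.* n ⟩
⊕⊛-cong-mod {N = N} {n} (entrywise p q r s) =
  entrywise (+-cong-mod (≡-mod-refl {a N}) (*-scale-mod {n = n} p))
            (+-cong-mod (≡-mod-refl {b N}) (*-scale-mod {n = n} q))
            (+-cong-mod (≡-mod-refl {c N}) (*-scale-mod {n = n} r))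
            (+-cong-mod (≡-mod-refl {d N}) (*-scale-mod {n = n} s))

≋-divisor : m ∣ n → M ≋ N ⟨mod n ⟩ → M ≋ N ⟨mod m ⟩
≋-divisor m∣n (entrywise p q r s) =
  entrywise (≡-mod-divisor m∣n p) (≡-mod-divisor m∣n q) (≡-mod-divisor m∣n r) (≡-mod-divisor m∣n s)

≋-crt : (∃ λ u → u * + n ≡ 1ℤ ⟨mod m ⟩) →
        M ≋ N ⟨mod m ⟩ → M ≋ N ⟨mod n ⟩ → M ≋ N ⟨mod m ℕ.* n ⟩
≋-crt inv (entrywise p q r s) (entrywise p′ q′ r′ s′) =
  entrywise (≡-mod-crt inv p p′) (≡-mod-crt inv q q′) (≡-mod-crt inv r r′) (≡-mod-crt inv s s′)

_∈_⟨mod_⟩ : Mat → (Mat → Set) → ℕ → Set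
M ∈ P ⟨mod n ⟩ = ∃ λ A → P A × A ≋ M ⟨mod n ⟩

mod⇒∈⟨mod⟩ : ∀ {P} → (P mod n) M → M ∈ P ⟨mod n ⟩
mod⇒∈⟨mod⟩ (A , A∈P , A≋M) = A , A∈P , ≋[mod]⇒≋⟨mod⟩ A≋M

∈⟨mod⟩⇒mod : ∀ {P} → M ∈ P ⟨mod n ⟩ → (P mod n) M
∈⟨mod⟩⇒mod (A , A∈P , A≋M) = A , A∈P , ≋⟨mod⟩⇒≋[mod] A≋M

∈⟨mod⟩-divisor : ∀ {P} → m ∣ n → M ∈ P ⟨mod n ⟩ → M ∈ P ⟨mod m ⟩
∈⟨mod⟩-divisor m∣n (A , A∈P , A≋M) = A , A∈P , ≋-divisor m∣n A≋M

pos-2*[2*n] : ∀ n → + (2 ℕ.* (2 ℕ.* n)) ≡ + 2 * (+ 2 * + n)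
pos-2*[2*n] n = trans (ℤₚ.pos-* 2 (2 ℕ.* n)) (cong (_*_ (+ 2)) (ℤₚ.pos-* 2 n))

-- (x I + 2n Q)² = x² I + 4n (x Q + n Q²)
≋-scalar-square : M ≋ scalar x ⟨mod 2 ℕ.* n ⟩ → M · M ≋ scalar (x * x) ⟨mod 2 ℕ.* (2 ℕ.* n) ⟩
≋-scalar-square {M} {x} {n} M≋x with ≋-elim (ℤₚ.pos-* 2 n) M≋x
... | mat q₁ q₂ q₃ q₄ , refl =
  ≋-intro (mat (x * q₁ + p * (q₁ * q₁ + q₂ * q₃)) (q₂ * (x + p * (q₁ + q₄)))
               (q₃ * (x + p * (q₁ + q₄))) (x * q₄ + p * (q₄ * q₄ + q₂ * q₃)))
          (pos-2*[2*n] n)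
          (mat-cong (diagonal x p q₁ q₂ q₃) (off-diagonal x p q₁ q₂ q₄)
                    (off-diagonal′ x p q₁ q₃ q₄) (diagonal′ x p q₄ q₂ q₃))
  where
  p = + n
  diagonal : ∀ x p q₁ q₂ q₃ →
    (x + q₁ * (+ 2 * p)) * (x + q₁ * (+ 2 * p)) + (0ℤ + q₂ * (+ 2 * p)) * (0ℤ + q₃ * (+ 2 * p)) ≡
    x * x + (x * q₁ + p * (q₁ * q₁ + q₂ * q₃)) * (+ 2 * (+ 2 * p))
  diagonal = solve-∀
  diagonal′ : ∀ x p q₄ q₂ q₃ →
    (0ℤ + q₃ * (+ 2 * p)) * (0ℤ + q₂ * (+ 2 * p)) + (x + q₄ * (+ 2 * p)) * (x + q₄ * (+ 2 * p)) ≡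
    x * x + (x * q₄ + p * (q₄ * q₄ + q₂ * q₃)) * (+ 2 * (+ 2 * p))
  diagonal′ = solve-∀
  off-diagonal : ∀ x p q₁ q₂ q₄ →
    (x + q₁ * (+ 2 * p)) * (0ℤ + q₂ * (+ 2 * p)) + (0ℤ + q₂ * (+ 2 * p)) * (x + q₄ * (+ 2 * p)) ≡
    0ℤ + q₂ * (x + p * (q₁ + q₄)) * (+ 2 * (+ 2 * p))
  off-diagonal = solve-∀
  off-diagonal′ : ∀ x p q₁ q₃ q₄ →
    (0ℤ + q₃ * (+ 2 * p)) * (x + q₁ * (+ 2 * p)) + (x + q₄ * (+ 2 * p)) * (0ℤ + q₃ * (+ 2 * p)) ≡
    0ℤ + q₃ * (x + p * (q₁ + q₄)) * (+ 2 * (+ 2 * p))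
  off-diagonal′ = solve-∀

-- Generation of SL(2,ℤ) and of Ψ₂

Generated-least : ∀ {S P : Mat → Set} →
                  P I₂ → (∀ {M} → S M → P M) → (∀ {M N} → P M → P N → P (M · N)) →
                  ∀ {M} → Generated S M → P M
Generated-least P-id S⊆P P-mul gen-id        = P-id
Generated-least P-id S⊆P P-mul (gen-inc s)   = S⊆P s
Generated-least P-id S⊆P P-mul (gen-mul g h) =
  P-mul (Generated-least P-id S⊆P P-mul g) (Generated-least P-id S⊆P P-mul h)

data Elementary : Mat → Set where
  upper-elementary : ∀ x → Elementary (upper x)
  lower-elementary : ∀ x → Elementary (lower x)

S-elementary : Generated Elementary S
S-elementary = gen-mul (gen-inc (upper-elementary -1ℤ))
                       (gen-mul (gen-inc (lower-elementary 1ℤ)) (gen-inc (upper-elementary -1ℤ)))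

∣x∣≡1⇒x≡±1 : ∀ x → ∣ x ∣ ≡ 1 → x ≡ 1ℤ ⊎ x ≡ -1ℤ
∣x∣≡1⇒x≡±1 (+ .1)      refl = inj₁ refl
∣x∣≡1⇒x≡±1 -[1+ zero ] refl = inj₂ refl

x*y≡1⇒x≡y≡±1 : ∀ x y → x * y ≡ 1ℤ → (x ≡ 1ℤ × y ≡ 1ℤ) ⊎ (x ≡ -1ℤ × y ≡ -1ℤ)
x*y≡1⇒x≡y≡±1 x y xy≡1
  with ∣x∣≡1⇒x≡±1 x (ℕₚ.m*n≡1⇒m≡1 ∣ x ∣ ∣ y ∣ ∣x∣∣y∣≡1)
     | ∣x∣≡1⇒x≡±1 y (ℕₚ.m*n≡1⇒n≡1 ∣ x ∣ ∣ y ∣ ∣x∣∣y∣≡1)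
  where
  ∣x∣∣y∣≡1 : ∣ x ∣ ℕ.* ∣ y ∣ ≡ 1
  ∣x∣∣y∣≡1 = trans (sym (ℤₚ.abs-* x y)) (cong ∣_∣ xy≡1)
x*y≡1⇒x≡y≡±1 .1ℤ  .1ℤ  _  | inj₁ refl | inj₁ refl = inj₁ (refl , refl)
x*y≡1⇒x≡y≡±1 .-1ℤ .-1ℤ _  | inj₂ refl | inj₂ refl = inj₂ (refl , refl)
x*y≡1⇒x≡y≡±1 .1ℤ  .-1ℤ () | inj₁ refl | inj₂ refl
x*y≡1⇒x≡y≡±1 .-1ℤ .1ℤ  () | inj₂ refl | inj₁ refl

upper-triangular-elementary : ∀ x y z → x * z - y * 0ℤ ≡ 1ℤ → Generated Elementary (mat x y 0ℤ z)
upper-triangular-elementary x y z det≡1 with x*y≡1⇒x≡y≡±1 x z (trans (sym (ring x y z)) det≡1)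
  where
  ring : ∀ x y z → x * z - y * 0ℤ ≡ x * z
  ring = solve-∀
... | inj₁ (refl , refl) = gen-inc (upper-elementary y)
... | inj₂ (refl , refl) =
  subst (Generated Elementary) (mat-cong refl (ring y) refl refl)
        (gen-mul S-elementary (gen-mul S-elementary (gen-inc (upper-elementary (- y)))))
  where
  ring : ∀ y → 0ℤ * (0ℤ * - y + -1ℤ * 1ℤ) + -1ℤ * (1ℤ * - y + 0ℤ * 1ℤ) ≡ y
  ring = solve-∀

column-reduction : ∀ r q b c d → upper q · (S · mat c d (- r) (q * d - b)) ≡ mat (r + q * c) b c d
column-reduction r q b c d = mat-cong (ring-a r q c) (ring-b q b d) (ring-c r c) (ring-d q b d)
  where
  ring-a : ∀ r q c → 1ℤ * (0ℤ * c + -1ℤ * - r) + q * (1ℤ * c + 0ℤ * - r) ≡ r + q * c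
  ring-a = solve-∀
  ring-b : ∀ q b d → 1ℤ * (0ℤ * d + -1ℤ * (q * d - b)) + q * (1ℤ * d + 0ℤ * (q * d - b)) ≡ b
  ring-b = solve-∀
  ring-c : ∀ r c → 0ℤ * (0ℤ * c + -1ℤ * - r) + 1ℤ * (1ℤ * c + 0ℤ * - r) ≡ c
  ring-c = solve-∀
  ring-d : ∀ q b d → 0ℤ * (0ℤ * d + -1ℤ * (q * d - b)) + 1ℤ * (1ℤ * d + 0ℤ * (q * d - b)) ≡ d
  ring-d = solve-∀

SL₂ℤ⊆⟨Elementary⟩ : ∀ M → InSL2ℤ M → Generated Elementary M
SL₂ℤ⊆⟨Elementary⟩ M = go M (<-wellFounded ∣ Mat.c M ∣)
  where
  step : ∀ a b c d .{{_ : ℤ.NonZero c}} →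
         (∀ {M} → ∣ Mat.c M ∣ ℕ.< ∣ c ∣ → InSL2ℤ M → Generated Elementary M) →
         a * d - b * c ≡ 1ℤ → Generated Elementary (mat a b c d)
  step a b c d recurse det≡1 =
    subst (Generated Elementary) (trans (column-reduction r q b c d) (cong (λ x → mat x b c d) (sym a≡r+qc)))
          (gen-mul (gen-inc (upper-elementary q))
                   (gen-mul S-elementary (recurse {mat c d (- r) (q * d - b)} ∣-r∣<∣c∣ det′≡1)))
    where
    r = + (a % c)
    q = a / c
    a≡r+qc : a ≡ r + q * c
    a≡r+qc = a≡a%n+[a/n]*n a c
    ∣-r∣<∣c∣ : ∣ - r ∣ ℕ.< ∣ c ∣
    ∣-r∣<∣c∣ = subst (ℕ._< ∣ c ∣) (sym (ℤₚ.∣-i∣≡∣i∣ r)) (n%d<d a c)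
    ring : ∀ r q b c d → c * (q * d - b) - d * - r ≡ (r + q * c) * d - b * c
    ring = solve-∀
    det′≡1 : c * (q * d - b) - d * - r ≡ 1ℤ
    det′≡1 = trans (ring r q b c d) (trans (cong (λ x → x * d - b * c) (sym a≡r+qc)) det≡1)
  go : ∀ M → Acc ℕ._<_ ∣ Mat.c M ∣ → InSL2ℤ M → Generated Elementary M
  go (mat a b (+ zero) d) _        = upper-triangular-elementary a b d
  go (mat a b +[1+ n ] d) (acc rs) = step a b +[1+ n ] d (λ lt → go _ (rs lt))
  go (mat a b -[1+ n ] d) (acc rs) = step a b -[1+ n ] d (λ lt → go _ (rs lt))

Ψ-det : ∀ {i} → Ψ i M → det M ≡ 1ℤ
Ψ-det = Generated-least refl generator-det (λ {M} {N} p q → trans (det-· M N) (cong₂ _*_ p q))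
  where
  generator-det : ∀ {i M} → Gens i M → det M ≡ 1ℤ
  generator-det g1a = refl
  generator-det g1b = refl
  generator-det g2a = refl
  generator-det g2b = refl

Ψ₂⊆Ψ : ∀ i → Ψ two M → Ψ i M
Ψ₂⊆Ψ one = Generated-least gen-id generator gen-mul
  where
  generator : ∀ {M} → Gens two M → Ψ one M
  generator g2a = gen-mul T (gen-mul T (gen-mul T T)) where T = gen-inc g1a
  generator g2b = gen-inc g1b
Ψ₂⊆Ψ two = id

upper∈Ψ₂ : 4 ∣ n → Ψ two (upper (+ n))
upper∈Ψ₂ (divides q refl) = multiple q
  where
  multiple : ∀ q → Ψ two (upper (+ (q ℕ.* 4)))
  multiple zero    = gen-id
  multiple (suc q) = subst (Ψ two) (upper-+ (+ 4) (+ (q ℕ.* 4))) (gen-mul (gen-inc g2a) (multiple q))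

lower∈Ψ₂ : 4 ∣ n → Ψ two (lower (+ n))
lower∈Ψ₂ (divides q refl) = multiple q
  where
  multiple : ∀ q → Ψ two (lower (+ (q ℕ.* 4)))
  multiple zero    = gen-id
  multiple (suc q) = subst (Ψ two) (lower-+ (+ 4) (+ (q ℕ.* 4))) (gen-mul (gen-inc g2b) (multiple q))

4∣2^[2+k] : ∀ k → 4 ∣ 2 ℕ.^ (2 ℕ.+ k)
4∣2^[2+k] k = *-monoʳ-∣ 2 (m∣m*n {2} (2 ℕ.^ k))

-- Odd moduli

Ψ₂∩Γ : ℕ → Mat → Set
Ψ₂∩Γ n X = Ψ two X × X ≋ I₂ ⟨mod n ⟩

SL₂ℤ⊆Ψ₂∩Γ[2^k]-mod-odd : ∀ t k B → InSL2ℤ B → B ∈ Ψ₂∩Γ (2 ℕ.^ k) ⟨mod suc (2 ℕ.* t) ⟩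
SL₂ℤ⊆Ψ₂∩Γ[2^k]-mod-odd t k B det≡1 =
  Generated-least (I₂ , (gen-id , ≋-refl) , ≋-refl) elementary product (SL₂ℤ⊆⟨Elementary⟩ B det≡1)
  where
  Target = λ M → M ∈ Ψ₂∩Γ (2 ℕ.^ k) ⟨mod suc (2 ℕ.* t) ⟩
  P = 2 ℕ.^ (2 ℕ.+ k)
  representative : ∀ x → ∃ λ r → + (P ℕ.* r) ≡ x ⟨mod suc (2 ℕ.* t) ⟩
  representative = multiple-representative P (2^-invertible-mod-odd t (2 ℕ.+ k))
  4∣P*r : ∀ r → 4 ∣ P ℕ.* r
  4∣P*r r = ∣m⇒∣m*n r (4∣2^[2+k] k)
  P*r≡0 : ∀ r → + (P ℕ.* r) ≡ 0ℤ ⟨mod 2 ℕ.^ k ⟩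
  P*r≡0 r = ∣⇒≡0-mod (∣m⇒∣m*n r (∣n⇒∣m*n 2 (n∣m*n 2)))
  elementary : ∀ {M} → Elementary M → Target M
  elementary (upper-elementary x) =
    let r , Pr≡x = representative x in
    upper (+ (P ℕ.* r)) , (upper∈Ψ₂ (4∣P*r r) , entrywise ≡-mod-refl (P*r≡0 r) ≡-mod-refl ≡-mod-refl) ,
    entrywise ≡-mod-refl Pr≡x ≡-mod-refl ≡-mod-refl
  elementary (lower-elementary x) =
    let r , Pr≡x = representative x in
    lower (+ (P ℕ.* r)) , (lower∈Ψ₂ (4∣P*r r) , entrywise ≡-mod-refl ≡-mod-refl (P*r≡0 r) ≡-mod-refl) ,
    entrywise ≡-mod-refl ≡-mod-refl Pr≡x ≡-mod-refl
  product : ∀ {M N} → Target M → Target N → Target (M · N)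
  product (X , (X∈Ψ₂ , X≋I) , X≋M) (Y , (Y∈Ψ₂ , Y≋I) , Y≋N) =
    X · Y , (gen-mul X∈Ψ₂ Y∈Ψ₂ , ·-cong-mod X≋I Y≋I) , ·-cong-mod X≋M Y≋N

part1 : ∀ i → Part1 i
part1 i .(suc (2 ℕ.* t)) k (t , refl) M = forward , backward
  where
  odd = suc (2 ℕ.* t)
  forward : (Ψ i mod (odd ℕ.* 2 ℕ.^ k)) M → (Ψ i mod odd) M × (Ψ i mod (2 ℕ.^ k)) M
  forward M∈Ψ = ∈⟨mod⟩⇒mod (∈⟨mod⟩-divisor (m∣m*n (2 ℕ.^ k)) (mod⇒∈⟨mod⟩ M∈Ψ)) ,
                ∈⟨mod⟩⇒mod (∈⟨mod⟩-divisor (n∣m*n odd) (mod⇒∈⟨mod⟩ M∈Ψ))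
  backward : (Ψ i mod odd) M × (Ψ i mod (2 ℕ.^ k)) M → (Ψ i mod (odd ℕ.* 2 ℕ.^ k)) M
  backward ((A₁ , A₁∈Ψ , A₁≋M) , (A₂ , A₂∈Ψ , A₂≋M)) =
    let X , (X∈Ψ₂ , X≋I) , X≋A₂⁻¹A₁ = SL₂ℤ⊆Ψ₂∩Γ[2^k]-mod-odd t k (adj A₂ · A₁) det≡1 in
    A₂ · X , gen-mul A₂∈Ψ (Ψ₂⊆Ψ i X∈Ψ₂) ,
    ≋⟨mod⟩⇒≋[mod] (≋-crt (2^-invertible-mod-odd t k)
      (≋-trans (·-cong-mod (≋-refl {A₂}) X≋A₂⁻¹A₁)
               (≋-trans (≋-reflexive (det≡1⇒·adj-cancelˡ A₂ A₁ (Ψ-det A₂∈Ψ))) (≋[mod]⇒≋⟨mod⟩ A₁≋M)))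
      (≋-trans (·-cong-mod (≋-refl {A₂}) X≋I)
               (≋-trans (≋-reflexive (·-identityʳ A₂)) (≋[mod]⇒≋⟨mod⟩ A₂≋M))))
    where
    det≡1 : det (adj A₂ · A₁) ≡ 1ℤ
    det≡1 = trans (det≡1⇒det-adj-· A₂ A₁ (Ψ-det A₂∈Ψ)) (Ψ-det A₁∈Ψ)

part2 : ∀ i → Part2 i
part2 i .(suc (2 ℕ.* t)) (t , refl) M = forward , backward
  where
  odd = suc (2 ℕ.* t)
  forward : (Ψ i mod odd) M → (InSL2ℤ mod odd) M
  forward (A , A∈Ψ , A≋M) = A , Ψ-det A∈Ψ , A≋M
  backward : (InSL2ℤ mod odd) M → (Ψ i mod odd) M
  backward (B , B∈SL₂ , B≋M) =
    let X , (X∈Ψ₂ , _) , X≋B = SL₂ℤ⊆Ψ₂∩Γ[2^k]-mod-odd t 0 B B∈SL₂ in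
    X , Ψ₂⊆Ψ i X∈Ψ₂ , ≋⟨mod⟩⇒≋[mod] (≋-trans X≋B (≋[mod]⇒≋⟨mod⟩ B≋M))

-- Powers of 2

pos-2^[k+j] : ∀ k j → + (2 ℕ.^ (k ℕ.+ j)) ≡ + (2 ℕ.^ k) * + (2 ℕ.^ j)
pos-2^[k+j] k j = trans (cong +_ (ℕₚ.^-distribˡ-+-* 2 k j)) (ℤₚ.pos-* (2 ℕ.^ k) (2 ℕ.^ j))

[1+2^[2+j]]²≡1+2^[3+j] : ∀ j →
  (1ℤ + + (2 ℕ.^ (2 ℕ.+ j))) * (1ℤ + + (2 ℕ.^ (2 ℕ.+ j))) ≡ 1ℤ + + (2 ℕ.^ (3 ℕ.+ j))
    ⟨mod 2 ℕ.^ (4 ℕ.+ j) ⟩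
[1+2^[2+j]]²≡1+2^[3+j] j = ≡-mod-intro p (pos-2^[k+j] 4 j) (begin
  (1ℤ + + (2 ℕ.^ (2 ℕ.+ j))) * (1ℤ + + (2 ℕ.^ (2 ℕ.+ j)))
    ≡⟨ cong (λ P → (1ℤ + P) * (1ℤ + P)) (pos-2^[k+j] 2 j) ⟩
  (1ℤ + + 4 * p) * (1ℤ + + 4 * p)
    ≡⟨ ring p ⟩
  1ℤ + + 8 * p + p * (+ 16 * p)
    ≡⟨ cong (λ P → 1ℤ + P + p * (+ 16 * p)) (pos-2^[k+j] 3 j) ⟨
  1ℤ + + (2 ℕ.^ (3 ℕ.+ j)) + p * (+ 16 * p)
    ∎)
  where
  open ≡-Reasoning
  p = + (2 ℕ.^ j)
  ring : ∀ p → (1ℤ + + 4 * p) * (1ℤ + + 4 * p) ≡ 1ℤ + + 8 * p + p * (+ 16 * p)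
  ring = solve-∀

record LevelElement (i : Idx) (j : ℕ) : Set where
  constructor level
  field
    element   : Mat
    element∈Ψ : Ψ i element
    element≋  : element ≋ scalar (1ℤ + + (2 ℕ.^ (2 ℕ.+ j))) ⟨mod 2 ℕ.^ (3 ℕ.+ j) ⟩

level-suc : ∀ {i j} → LevelElement i j → LevelElement i (suc j)
level-suc {j = j} (level W W∈Ψ W≋) =
  level (W · W) (gen-mul W∈Ψ W∈Ψ)
        (≋-trans (≋-scalar-square {n = 2 ℕ.^ (2 ℕ.+ j)} W≋) (scalar-cong-mod ([1+2^[2+j]]²≡1+2^[3+j] j)))

level-iterate : ∀ {i j} → LevelElement i j → ∀ d → LevelElement i (d ℕ.+ j)
level-iterate W zero    = W
level-iterate W (suc d) = level-suc (level-iterate W d)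

level-power : ∀ {i j} → LevelElement i j → ∀ ε → ε ℕ.< 2 →
              ∃ λ V → Ψ i V × V ≋ scalar (1ℤ + + ε * + (2 ℕ.^ (2 ℕ.+ j))) ⟨mod 2 ℕ.^ (3 ℕ.+ j) ⟩
level-power _ 0 _ = I₂ , gen-id , ≋-refl
level-power {j = j} (level W W∈Ψ W≋) 1 _ =
  W , W∈Ψ , ≋-trans W≋ (≋-reflexive (cong (λ x → scalar (1ℤ + x)) (sym (ℤₚ.*-identityˡ P))))
  where P = + (2 ℕ.^ (2 ℕ.+ j))
level-power _ (suc (suc _)) (ℕ.s≤s (ℕ.s≤s ()))

upper-2^[2+j]∈Ψ : ∀ i j ε → Ψ i (upper (+ ε * + (2 ℕ.^ (2 ℕ.+ j))))
upper-2^[2+j]∈Ψ i j ε =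
  Ψ₂⊆Ψ i (subst (Ψ two ∘ upper) (ℤₚ.pos-* ε _) (upper∈Ψ₂ (∣n⇒∣m*n ε (4∣2^[2+k] j))))

lower-2^[2+j]∈Ψ : ∀ i j ε → Ψ i (lower (+ ε * + (2 ℕ.^ (2 ℕ.+ j))))
lower-2^[2+j]∈Ψ i j ε =
  Ψ₂⊆Ψ i (subst (Ψ two ∘ lower) (ℤₚ.pos-* ε _) (lower∈Ψ₂ (∣n⇒∣m*n ε (4∣2^[2+k] j))))

elementary-scalar-product : ∀ {P} n → P ≡ + 2 * + n → ∀ e₁ e₂ e₃ →
  upper (e₂ * P) · (lower (e₃ * P) · scalar (1ℤ + e₁ * P)) ≋ I₂ ⊕ mat e₁ e₂ e₃ e₁ ⊛ P
    ⟨mod 2 ℕ.* (2 ℕ.* n) ⟩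
elementary-scalar-product n refl e₁ e₂ e₃ =
  ≋-intro (mat (e₂ * e₃ * p * (1ℤ + e₁ * (+ 2 * p))) (e₁ * e₂ * p) (e₁ * e₃ * p) 0ℤ) (pos-2*[2*n] n)
          (mat-cong (ring-a e₁ e₂ e₃ p) (ring-b e₁ e₂ e₃ p) (ring-c e₁ e₂ e₃ p) (ring-d e₁ e₂ e₃ p))
  where
  p = + n
  ring-a : ∀ e₁ e₂ e₃ p →
    1ℤ * (1ℤ * (1ℤ + e₁ * (+ 2 * p)) + 0ℤ * 0ℤ) +
    e₂ * (+ 2 * p) * (e₃ * (+ 2 * p) * (1ℤ + e₁ * (+ 2 * p)) + 1ℤ * 0ℤ) ≡
    1ℤ + e₁ * (+ 2 * p) + e₂ * e₃ * p * (1ℤ + e₁ * (+ 2 * p)) * (+ 2 * (+ 2 * p))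
  ring-a = solve-∀
  ring-b : ∀ e₁ e₂ e₃ p →
    1ℤ * (1ℤ * 0ℤ + 0ℤ * (1ℤ + e₁ * (+ 2 * p))) +
    e₂ * (+ 2 * p) * (e₃ * (+ 2 * p) * 0ℤ + 1ℤ * (1ℤ + e₁ * (+ 2 * p))) ≡
    0ℤ + e₂ * (+ 2 * p) + e₁ * e₂ * p * (+ 2 * (+ 2 * p))
  ring-b = solve-∀
  ring-c : ∀ e₁ e₂ e₃ p →
    0ℤ * (1ℤ * (1ℤ + e₁ * (+ 2 * p)) + 0ℤ * 0ℤ) +
    1ℤ * (e₃ * (+ 2 * p) * (1ℤ + e₁ * (+ 2 * p)) + 1ℤ * 0ℤ) ≡
    0ℤ + e₃ * (+ 2 * p) + e₁ * e₃ * p * (+ 2 * (+ 2 * p))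
  ring-c = solve-∀
  ring-d : ∀ e₁ e₂ e₃ p →
    0ℤ * (1ℤ * 0ℤ + 0ℤ * (1ℤ + e₁ * (+ 2 * p))) +
    1ℤ * (e₃ * (+ 2 * p) * 0ℤ + 1ℤ * (1ℤ + e₁ * (+ 2 * p))) ≡
    1ℤ + e₁ * (+ 2 * p) + 0ℤ * (+ 2 * (+ 2 * p))
  ring-d = solve-∀

-- det (I + P Y) = 1 + P (tr Y + P det Y), and P is even.
trace-even : ∀ {P} n .{{_ : ℕ.NonZero n}} → P ≡ + 2 * + n → ∀ Y →
             det (I₂ ⊕ Y ⊛ P) ≡ 1ℤ ⟨mod 2 ℕ.* (2 ℕ.* n) ⟩ → d Y ≡ a Y ⟨mod 2 ⟩
trace-even n refl (mat y₁ y₂ y₃ y₄) det≡1 =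
  let z , det≡1+z4n = ≡-mod-elim (pos-2*[2*n] n) det≡1
      T≡2z : T ≡ z * + 2
      T≡2z = ℤₚ.*-cancelˡ-≡ P T (z * + 2) {{ℤₚ.i*j≢0 (+ 2) p}}
               (trans (expand y₁ y₂ y₃ y₄ P) (trans (cong (_- 1ℤ) det≡1+z4n) (collapse z P)))
  in by-quotient (z - y₁ - p * D) (begin
    y₄                                ≡⟨ isolate y₁ y₄ p D ⟩
    T - y₁ - P * D                    ≡⟨ cong (λ t → t - y₁ - P * D) T≡2z ⟩
    z * + 2 - y₁ - P * D              ≡⟨ regroup y₁ p D z ⟩
    y₁ + (z - y₁ - p * D) * + 2       ∎)
  where
  open ≡-Reasoning
  p = + n
  P = + 2 * p
  D = y₁ * y₄ - y₂ * y₃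
  T = y₁ + y₄ + P * D
  expand : ∀ y₁ y₂ y₃ y₄ P → P * (y₁ + y₄ + P * (y₁ * y₄ - y₂ * y₃)) ≡
           (1ℤ + y₁ * P) * (1ℤ + y₄ * P) - (0ℤ + y₂ * P) * (0ℤ + y₃ * P) - 1ℤ
  expand = solve-∀
  collapse : ∀ z P → 1ℤ + z * (+ 2 * P) - 1ℤ ≡ P * (z * + 2)
  collapse = solve-∀
  isolate : ∀ y₁ y₄ p D → y₄ ≡ y₁ + y₄ + + 2 * p * D - y₁ - + 2 * p * D
  isolate = solve-∀
  regroup : ∀ y₁ p D z → z * + 2 - y₁ - + 2 * p * D ≡ y₁ + (z - y₁ - p * D) * + 2
  regroup = solve-∀

kernel-lift : ∀ {i j B} → LevelElement i j → B ≋ I₂ ⟨mod 2 ℕ.^ (2 ℕ.+ j) ⟩ →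
              det B ≡ 1ℤ ⟨mod 2 ℕ.^ (3 ℕ.+ j) ⟩ → B ∈ Ψ i ⟨mod 2 ℕ.^ (3 ℕ.+ j) ⟩
kernel-lift {i} {j} W B≋I det≡1 with ≋-elim refl B≋I
... | Y , refl =
  let V , V∈Ψ , V≋ = level-power W ε₁ (n%ℕd<d (a Y) 2) in
  upper (+ ε₂ * P) · (lower (+ ε₃ * P) · V) ,
  gen-mul (upper-2^[2+j]∈Ψ i j ε₂) (gen-mul (lower-2^[2+j]∈Ψ i j ε₃) V∈Ψ) ,
  ≋-trans (·-cong-mod (≋-refl {upper (+ ε₂ * P)}) (·-cong-mod (≋-refl {lower (+ ε₃ * P)}) V≋))
          (≋-trans (elementary-scalar-product (2 ℕ.^ suc j) P≡2*2^[1+j] (+ ε₁) (+ ε₂) (+ ε₃))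
                   (≋-sym (⊕⊛-cong-mod {N = I₂} {n = 2 ℕ.^ (2 ℕ.+ j)} Y≋ε)))
  where
  P = + (2 ℕ.^ (2 ℕ.+ j))
  P≡2*2^[1+j] : P ≡ + 2 * + (2 ℕ.^ suc j)
  P≡2*2^[1+j] = ℤₚ.pos-* 2 (2 ℕ.^ suc j)
  ε₁ = a Y %ℕ 2
  ε₂ = b Y %ℕ 2
  ε₃ = c Y %ℕ 2
  Y≋ε : Y ≋ mat (+ ε₁) (+ ε₂) (+ ε₃) (+ ε₁) ⟨mod 2 ⟩
  Y≋ε = entrywise (≡%ℕ-mod (a Y) 2) (≡%ℕ-mod (b Y) 2) (≡%ℕ-mod (c Y) 2)
          (≡-mod-trans (trace-even (2 ℕ.^ suc j) {{ℕₚ.m^n≢0 2 (suc j)}} P≡2*2^[1+j] Y det≡1)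
                       (≡%ℕ-mod (a Y) 2))

lift-step : ∀ {i j M} → LevelElement i j → det M ≡ 1ℤ ⟨mod 2 ℕ.^ (3 ℕ.+ j) ⟩ →
            M ∈ Ψ i ⟨mod 2 ℕ.^ (2 ℕ.+ j) ⟩ → M ∈ Ψ i ⟨mod 2 ℕ.^ (3 ℕ.+ j) ⟩
lift-step {j = j} {M} W detM≡1 (A , A∈Ψ , A≋M) =
  let K , K∈Ψ , K≋A⁻¹M = kernel-lift W A⁻¹M≋I detA⁻¹M≡1 in
  A · K , gen-mul A∈Ψ K∈Ψ ,
  ≋-trans (·-cong-mod (≋-refl {A}) K≋A⁻¹M) (≋-reflexive (det≡1⇒·adj-cancelˡ A M (Ψ-det A∈Ψ)))
  where
  A⁻¹M≋I : adj A · M ≋ I₂ ⟨mod 2 ℕ.^ (2 ℕ.+ j) ⟩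
  A⁻¹M≋I = ≋-trans (·-cong-mod (≋-refl {adj A}) (≋-sym A≋M))
                   (≋-reflexive (trans (adj-· A) (cong scalar (Ψ-det A∈Ψ))))
  detA⁻¹M≡1 : det (adj A · M) ≡ 1ℤ ⟨mod 2 ℕ.^ (3 ℕ.+ j) ⟩
  detA⁻¹M≡1 = subst (λ x → x ≡ 1ℤ ⟨mod 2 ℕ.^ (3 ℕ.+ j) ⟩)
                    (sym (det≡1⇒det-adj-· A M (Ψ-det A∈Ψ))) detM≡1

lift : ∀ {i j M} → LevelElement i j → ∀ d → det M ≡ 1ℤ ⟨mod 2 ℕ.^ (2 ℕ.+ (d ℕ.+ j)) ⟩ →
       M ∈ Ψ i ⟨mod 2 ℕ.^ (2 ℕ.+ j) ⟩ → M ∈ Ψ i ⟨mod 2 ℕ.^ (2 ℕ.+ (d ℕ.+ j)) ⟩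
lift W zero    _      M∈Ψ = M∈Ψ
lift W (suc d) detM≡1 M∈Ψ =
  lift-step (level-iterate W d) detM≡1 (lift W d (≡-mod-divisor (n∣m*n 2) detM≡1) M∈Ψ)

^-monoʳ-∣ : ∀ b {m n} → m ℕ.≤ n → b ℕ.^ m ∣ b ℕ.^ n
^-monoʳ-∣ b {m} m≤n =
  let o , m+o≡n = ℕₚ.m≤n⇒∃[o]m+o≡n m≤n in
  subst (λ k → b ℕ.^ m ∣ b ℕ.^ k) m+o≡n
        (subst (b ℕ.^ m ∣_) (sym (ℕₚ.^-distribˡ-+-* b m o)) (m∣m*n (b ℕ.^ o)))

∈Ψ⟨mod⟩⇒det≡1 : ∀ {i} → M ∈ Ψ i ⟨mod n ⟩ → det M ≡ 1ℤ ⟨mod n ⟩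
∈Ψ⟨mod⟩⇒det≡1 (A , A∈Ψ , A≋M) =
  ≡-mod-trans (≡-mod-sym (det-cong-mod A≋M)) (≡-mod-reflexive (Ψ-det A∈Ψ))

full-preimage : ∀ {i j} → LevelElement i j → FullPreimageFrom i (2 ℕ.+ j)
full-preimage {i} {j} W k 2+j≤k M = forward , backward
  where
  forward : (Ψ i mod (2 ℕ.^ k)) M → InSL2mod (2 ℕ.^ k) M × (Ψ i mod (2 ℕ.^ (2 ℕ.+ j))) M
  forward M∈Ψ = ⟨mod⟩⇒[mod] (∈Ψ⟨mod⟩⇒det≡1 (mod⇒∈⟨mod⟩ M∈Ψ)) ,
                ∈⟨mod⟩⇒mod (∈⟨mod⟩-divisor (^-monoʳ-∣ 2 2+j≤k) (mod⇒∈⟨mod⟩ M∈Ψ))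
  extra = proj₁ (ℕₚ.m≤n⇒∃[o]m+o≡n 2+j≤k)
  2+[extra+j]≡k : 2 ℕ.+ (extra ℕ.+ j) ≡ k
  2+[extra+j]≡k = trans (cong (2 ℕ.+_) (ℕₚ.+-comm extra j)) (proj₂ (ℕₚ.m≤n⇒∃[o]m+o≡n 2+j≤k))
  backward : InSL2mod (2 ℕ.^ k) M × (Ψ i mod (2 ℕ.^ (2 ℕ.+ j))) M → (Ψ i mod (2 ℕ.^ k)) M
  backward (detM≡1 , M∈Ψ) =
    ∈⟨mod⟩⇒mod (subst (λ e → M ∈ Ψ i ⟨mod 2 ℕ.^ e ⟩) 2+[extra+j]≡k
      (lift W extra (subst (λ e → det M ≡ 1ℤ ⟨mod 2 ℕ.^ e ⟩) (sym 2+[extra+j]≡k) ([mod]⇒⟨mod⟩ detM≡1))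
                    (mod⇒∈⟨mod⟩ M∈Ψ)))

level-one : LevelElement one 0
level-one =
  level (mat (+ 77) (+ 16) (+ 24) (+ 5)) (gen-mul T (gen-mul T (gen-mul T (gen-mul L (gen-mul T L)))))
        (entrywise (by-quotient (+ 9) refl) (by-quotient (+ 2) refl) (by-quotient (+ 3) refl) (by-quotient 0ℤ refl))
  where
  T = gen-inc g1a
  L = gen-inc g1b

level-two : LevelElement two 2
level-two =
  level (mat (+ 13553) (+ 480) (+ 480) (+ 17)) (gen-mul (⁷ T) (gen-mul L (gen-mul T (⁷ L))))
        (entrywise (by-quotient (+ 423) refl) (by-quotient (+ 15) refl) (by-quotient (+ 15) refl) (by-quotient 0ℤ refl))
  where
  T = gen-inc g2a
  L = gen-inc g2b
  ⁷ : ∀ {X} → Ψ two X → Ψ two (X · (X · (X · (X · (X · (X · X))))))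
  ⁷ x = gen-mul x (gen-mul x (gen-mul x (gen-mul x (gen-mul x (gen-mul x x)))))

part4 : ∀ i → Part4 i
part4 one = full-preimage level-one
part4 two = full-preimage level-two

theorem7p1 : (i : Idx) → Part1 i × Part2 i × Part3 i × Part4 i
theorem7p1 i = part1 i , part2 i , (e i , e≥1 i , part4 i) , part4 i
  where
  e≥1 : ∀ i → e i ℕ.≥ 1
  e≥1 one = ℕ.s≤s ℕ.z≤n
  e≥1 two = ℕ.s≤s ℕ.z≤n
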